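{- Let $p \geq 5$ be a prime such that $W_p = (2^p+1)/3$ is prime. Let $\omega_3 = 3 + 2\sqrt{2} \in \mathbb{Z}[\sqrt{2}]$. Then \[ \omega_3^{(W_p+1)/2} \equiv -1 \pmod{W_p}, \] where the congruence is in the ring $\mathbb{Z}[\sqrt{2}]$, i.e. $\omega_3^{(W_p+1)/2} + 1 \in W_p\,\mathbb{Z}[\sqrt{2}]$.
   Context: For an odd prime $p$, the Wagstaff number is $W_p = (2^p+1)/3$. -}

module Defs where

open import Data.Nat as ℕ using (ℕ; zero; suc)
open import Data.Integer as ℤ using (ℤ; +_)
open import Data.Integer.Divisibility using (_∣_)
open import Data.Product using (_×_; _,_)

-- The ring ℤ[√2]: a + b√2 represented as ⟨ a , b ⟩.
record ℤ√2 : Set where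
  constructor ⟨_,_⟩
  field
    re : ℤ
    im : ℤ
open ℤ√2 public

infixl 7 _*√_
infixl 6 _+√_

_+√_ : ℤ√2 → ℤ√2 → ℤ√2
⟨ a , b ⟩ +√ ⟨ c , d ⟩ = ⟨ a ℤ.+ c , b ℤ.+ d ⟩

_*√_ : ℤ√2 → ℤ√2 → ℤ√2
⟨ a , b ⟩ *√ ⟨ c , d ⟩ = ⟨ a ℤ.* c ℤ.+ + 2 ℤ.* (b ℤ.* d) , a ℤ.* d ℤ.+ b ℤ.* c ⟩

one√ : ℤ√2
one√ = ⟨ + 1 , + 0 ⟩

_^√_ : ℤ√2 → ℕ → ℤ√2
x ^√ zero = one√
x ^√ suc n = x *√ (x ^√ n)

ι : ℤ → ℤ√2
ι a = ⟨ a , + 0 ⟩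

ω₃ : ℤ√2
ω₃ = ⟨ + 3 , + 2 ⟩

-- x ∈ n·ℤ[√2]  (an element a + b√2 lies in the ideal n ℤ[√2] iff n ∣ a and n ∣ b)
_∣√_ : ℤ → ℤ√2 → Set
n ∣√ ⟨ a , b ⟩ = (n ∣ a) × (n ∣ b)

W : ℕ → ℕ
W p = (2 ℕ.^ p ℕ.+ 1) ℕ./ 3

-- Write W = W_p. As p is odd, 2^p = 2 + 6t with t odd, so W = 2t + 1 and (W + 1)/2 = t + 1.
-- Work in ℤ[√2]/W. Since ω₃ = (1 + √2)², we get ω₃^(t+1) = (1 + √2)(1 + √2)^W, and as W is
-- prime the Frobenius map gives (1 + √2)^W ≡ 1 + √2^W = 1 + √2·2^t. Fermat's little theorem
-- (Frobenius again, modulo p) gives p ∣ 2^p − 2 = 6t, so as p ≥ 5 and t is odd, t = kp with k odd;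
-- as 3W = 2^p + 1, 2^t = (2^p)^k ≡ (−1)^k = −1. Hence (1 + √2)^W ≡ 1 − √2 and
-- ω₃^(t+1) ≡ (1 + √2)(1 − √2) = −1.

module Submission where

open import Defs
open import Data.Nat using (ℕ; zero; suc)
open import Data.Nat.Primality using (Prime)
open import Data.Integer using (+_; -[1+_])
open import Data.Product using (∃-syntax; _,_)
open import Data.Sum using (inj₁; inj₂)
open import Level using (0ℓ)
open import Algebra.Bundles using (CommutativeSemiring)
open import Relation.Binary.PropositionalEquality
  using (_≡_; refl; sym; trans; cong; cong₂; subst; subst₂; module ≡-Reasoning)
open import Relation.Nullary using (contradiction)

-1√ √2 -√2 1+√2 1-√2 : ℤ√2
-1√  = ι -[1+ 0 ]
√2   = ⟨ + 0 , + 1 ⟩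
-√2  = ⟨ + 0 , -[1+ 0 ] ⟩
1+√2 = ⟨ + 1 , + 1 ⟩
1-√2 = ⟨ + 1 , -[1+ 0 ] ⟩

module ℤ√2-Properties where
  import Data.Nat as ℕ
  open import Data.Nat using (parity)
  open import Data.Integer using (_+_; _*_)
  open import Data.Integer.Properties
    using (+-assoc; +-comm; +-identityˡ; +-identityʳ; *-comm; *-identityˡ; *-zeroʳ; pos-*)
  open import Data.Integer.Tactic.RingSolver using (solve-∀)
  open import Data.Parity.Base using (1ℙ)

  zero√ : ℤ√2
  zero√ = ι (+ 0)

  +√-assoc : ∀ x y z → (x +√ y) +√ z ≡ x +√ (y +√ z)
  +√-assoc x y z = cong₂ ⟨_,_⟩ (+-assoc (re x) (re y) (re z)) (+-assoc (im x) (im y) (im z))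

  +√-comm : ∀ x y → x +√ y ≡ y +√ x
  +√-comm x y = cong₂ ⟨_,_⟩ (+-comm (re x) (re y)) (+-comm (im x) (im y))

  +√-identityˡ : ∀ x → zero√ +√ x ≡ x
  +√-identityˡ x = cong₂ ⟨_,_⟩ (+-identityˡ (re x)) (+-identityˡ (im x))

  *√-comm : ∀ x y → x *√ y ≡ y *√ x
  *√-comm ⟨ a , b ⟩ ⟨ c , d ⟩ =
    cong₂ ⟨_,_⟩ (cong₂ _+_ (*-comm a c) (cong (+ 2 *_) (*-comm b d)))
                (trans (+-comm (a * d) (b * c)) (cong₂ _+_ (*-comm b c) (*-comm a d)))

  *√-identityˡ : ∀ x → one√ *√ x ≡ x
  *√-identityˡ x = cong₂ ⟨_,_⟩ (1*a+0≡a (re x)) (1*a+0≡a (im x))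
    where
    1*a+0≡a : ∀ a → + 1 * a + + 0 ≡ a
    1*a+0≡a a = trans (+-identityʳ (+ 1 * a)) (*-identityˡ a)

  *√-zeroˡ : ∀ x → zero√ *√ x ≡ zero√
  *√-zeroˡ x = refl

  *√-assoc : ∀ x y z → (x *√ y) *√ z ≡ x *√ (y *√ z)
  *√-assoc ⟨ a , b ⟩ ⟨ c , d ⟩ ⟨ e , f ⟩ = cong₂ ⟨_,_⟩ (re-assoc a b c d e f) (im-assoc a b c d e f)
    where
    re-assoc : ∀ a b c d e f →
      (a * c + + 2 * (b * d)) * e + + 2 * ((a * d + b * c) * f) ≡
      a * (c * e + + 2 * (d * f)) + + 2 * (b * (c * f + d * e))
    re-assoc = solve-∀
    im-assoc : ∀ a b c d e f →
      (a * c + + 2 * (b * d)) * f + (a * d + b * c) * e ≡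
      a * (c * f + d * e) + b * (c * e + + 2 * (d * f))
    im-assoc = solve-∀

  *√-distribʳ : ∀ x y z → (y +√ z) *√ x ≡ (y *√ x) +√ (z *√ x)
  *√-distribʳ ⟨ a , b ⟩ ⟨ c , d ⟩ ⟨ e , f ⟩ = cong₂ ⟨_,_⟩ (re-distrib a b c d e f) (im-distrib a b c d e f)
    where
    re-distrib : ∀ a b c d e f →
      (c + e) * a + + 2 * ((d + f) * b) ≡ (c * a + + 2 * (d * b)) + (e * a + + 2 * (f * b))
    re-distrib = solve-∀
    im-distrib : ∀ a b c d e f →
      (c + e) * b + (d + f) * a ≡ (c * b + d * a) + (e * b + f * a)
    im-distrib = solve-∀

  ι-* : ∀ a b → ι a *√ ι b ≡ ι (a * b)
  ι-* a b = cong₂ ⟨_,_⟩ (+-identityʳ (a * b)) (trans (+-identityʳ (a * + 0)) (*-zeroʳ a))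

  ι-^√ : ∀ a k → ι (+ a) ^√ k ≡ ι (+ (a ℕ.^ k))
  ι-^√ a zero    = refl
  ι-^√ a (suc k) = begin
    ι (+ a) *√ ι (+ a) ^√ k       ≡⟨ cong (ι (+ a) *√_) (ι-^√ a k) ⟩
    ι (+ a) *√ ι (+ (a ℕ.^ k))    ≡⟨ ι-* (+ a) (+ (a ℕ.^ k)) ⟩
    ι (+ a * + (a ℕ.^ k))         ≡⟨ cong ι (pos-* a (a ℕ.^ k)) ⟨
    ι (+ (a ℕ.* a ℕ.^ k))         ∎
    where open ≡-Reasoning

  one√-^√ : ∀ k → one√ ^√ k ≡ one√
  one√-^√ zero    = refl
  one√-^√ (suc k) = cong (one√ *√_) (one√-^√ k)

  -1√-^√-odd : ∀ k → parity k ≡ 1ℙ → -1√ ^√ k ≡ -1√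
  -1√-^√-odd 1             _   = refl
  -1√-^√-odd (suc (suc k)) odd = cong (λ x → -1√ *√ (-1√ *√ x)) (-1√-^√-odd k odd)

open ℤ√2-Properties

module PrimeDivisibility where
  open import Data.Nat using (_*_; _∸_; _<_; _!; nonTrivial⇒≢1)
  open import Data.Nat.Properties using (<-trans; n<1+n; <⇒≤; ∸-monoʳ-<; _!*_!≢0)
  open import Data.Nat.Divisibility using (_∣_; _∤_; >⇒∤; ∣1⇒≡1; m∣m*n)
  open import Data.Nat.DivMod using (m*[n/m]≡n)
  open import Data.Nat.Combinatorics using (_C_; nCk≡n!/k![n-k]!; k![n∸k]!∣n!)
  open import Data.Nat.Primality using (euclidsLemma; prime⇒nonTrivial)

  ∣m*n∧∤m⇒∣n : ∀ {p m n} → Prime p → p ∣ m * n → p ∤ m → p ∣ n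
  ∣m*n∧∤m⇒∣n {m = m} {n} p-prime p∣m*n p∤m with euclidsLemma m n p-prime p∣m*n
  ... | inj₁ p∣m = contradiction p∣m p∤m
  ... | inj₂ p∣n = p∣n

  ∤m∧∤n⇒∤m*n : ∀ {p m n} → Prime p → p ∤ m → p ∤ n → p ∤ m * n
  ∤m∧∤n⇒∤m*n p-prime p∤m p∤n p∣m*n = p∤n (∣m*n∧∤m⇒∣n p-prime p∣m*n p∤m)

  prime∤! : ∀ {p} → Prime p → ∀ n → n < p → p ∤ n !
  prime∤! p-prime zero    _   p∣1      = nonTrivial⇒≢1 {{prime⇒nonTrivial p-prime}} (∣1⇒≡1 p∣1)
  prime∤! p-prime (suc n) n<p p∣[1+n]! =
    prime∤! p-prime n (<-trans (n<1+n n) n<p) (∣m*n∧∤m⇒∣n p-prime p∣[1+n]! (>⇒∤ n<p))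

  prime∣binomial : ∀ {p k} → Prime p → 0 < k → k < p → p ∣ p C k
  prime∣binomial {p@(suc r)} {k} p-prime 0<k k<p =
    ∣m*n∧∤m⇒∣n p-prime (subst (p ∣_) (sym k![p∸k]!*pCk≡p!) (m∣m*n (r !)))
      (∤m∧∤n⇒∤m*n p-prime (prime∤! p-prime k k<p) (prime∤! p-prime (p ∸ k) (∸-monoʳ-< 0<k (<⇒≤ k<p))))
    where
    instance _ = k !* (p ∸ k) !≢0
    k![p∸k]!*pCk≡p! : k ! * (p ∸ k) ! * (p C k) ≡ p !
    k![p∸k]!*pCk≡p! = trans (cong (k ! * (p ∸ k) ! *_) (nCk≡n!/k![n-k]! (<⇒≤ k<p)))
                            (m*[n/m]≡n (k![n∸k]!∣n! (<⇒≤ k<p)))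

open PrimeDivisibility

module Frobenius {c ℓ} (S : CommutativeSemiring c ℓ) where
  open CommutativeSemiring S hiding (zero) renaming (trans to ≈-trans)
  open import Algebra.Properties.Semiring.Exp semiring using (_^_)
  open import Algebra.Properties.Semiring.Mult semiring using (_×_; ×-congʳ; ×-homo-1; ×-assocˡ; ×-assoc-*)
  open import Algebra.Properties.Monoid.Sum +-monoid using (sum; sum-init-last; sum-cong-≋; sum-replicate-zero)
  open import Algebra.Properties.CommutativeSemiring.Binomial S using (theorem; binomialTerm)
  import Data.Nat as ℕ
  open import Data.Nat using (z≤n; s≤s)
  import Data.Nat.Properties as ℕ
  open import Data.Nat.Divisibility using (_∣_; divides-refl)
  open import Data.Nat.Combinatorics using (nCn≡1)
  open import Data.Fin using (zero; suc; fromℕ; inject₁)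
  open import Data.Fin.Properties using (toℕ-fromℕ; inject₁ℕ<)
  open import Data.Vec.Functional using (Vector)
  open import Relation.Binary.Reasoning.Setoid setoid

  ×1≈0⇒×≈0 : ∀ {q} → q × 1# ≈ 0# → ∀ x → q × x ≈ 0#
  ×1≈0⇒×≈0 {q} q×1≈0 x = begin
    q × x          ≈⟨ ×-congʳ q (*-identityˡ x) ⟨
    q × (1# * x)   ≈⟨ ×-assoc-* q 1# x ⟨
    (q × 1#) * x   ≈⟨ *-congʳ q×1≈0 ⟩
    0# * x         ≈⟨ zeroˡ x ⟩
    0#             ∎

  ×1≈0∧∣⇒×≈0 : ∀ {q m} → q × 1# ≈ 0# → q ∣ m → ∀ x → m × x ≈ 0#
  ×1≈0∧∣⇒×≈0 {q} q×1≈0 (divides-refl k) x = begin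
    (k ℕ.* q) × x  ≡⟨ cong (_× x) (ℕ.*-comm k q) ⟩
    (q ℕ.* k) × x  ≈⟨ ×-assocˡ x q k ⟨
    q × (k × x)    ≈⟨ ×1≈0⇒×≈0 {q} q×1≈0 (k × x) ⟩
    0#             ∎

  sum≈first+last : ∀ {m} (t : Vector Carrier (suc (suc m))) → (∀ i → t (suc (inject₁ i)) ≈ 0#) →
                   sum t ≈ t zero + t (fromℕ (suc m))
  sum≈first+last {m} t inner≈0 = +-congˡ (begin
    sum (λ i → t (suc i))                                 ≈⟨ sum-init-last (λ i → t (suc i)) ⟩
    sum (λ i → t (suc (inject₁ i))) + t (fromℕ (suc m))  ≈⟨ +-congʳ (≈-trans (sum-cong-≋ inner≈0) (sum-replicate-zero m)) ⟩
    0# + t (fromℕ (suc m))                                ≈⟨ +-identityˡ _ ⟩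
    t (fromℕ (suc m))                                     ∎)

  binomialTerm-first : ∀ x y m → binomialTerm x y m zero ≈ y ^ m
  binomialTerm-first x y m = begin
    1 × (1# * y ^ m)   ≈⟨ ×-homo-1 _ ⟩
    1# * y ^ m         ≈⟨ *-identityˡ (y ^ m) ⟩
    y ^ m              ∎

  binomialTerm-last : ∀ x y m → binomialTerm x y m (fromℕ m) ≈ x ^ m
  binomialTerm-last x y m rewrite toℕ-fromℕ m | nCn≡1 m | ℕ.n∸n≡0 m = begin
    1 × (x ^ m * 1#)   ≈⟨ ×-homo-1 _ ⟩
    x ^ m * 1#         ≈⟨ *-identityʳ (x ^ m) ⟩
    x ^ m              ∎

  frobenius : ∀ {q} → Prime q → q × 1# ≈ 0# → ∀ x y → (x + y) ^ q ≈ x ^ q + y ^ q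
  frobenius {q@(suc r)} q-prime q×1≈0 x y = begin
    (x + y) ^ q                                              ≈⟨ theorem q x y ⟩
    sum (binomialTerm x y q)                                 ≈⟨ sum≈first+last (binomialTerm x y q) inner≈0 ⟩
    binomialTerm x y q zero + binomialTerm x y q (fromℕ q)   ≈⟨ +-comm _ _ ⟩
    binomialTerm x y q (fromℕ q) + binomialTerm x y q zero   ≈⟨ +-cong (binomialTerm-last x y q) (binomialTerm-first x y q) ⟩
    x ^ q + y ^ q                                            ∎
    where
    inner≈0 : ∀ i → binomialTerm x y q (suc (inject₁ i)) ≈ 0#
    inner≈0 i = ×1≈0∧∣⇒×≈0 q×1≈0 (prime∣binomial q-prime (s≤s z≤n) (s≤s (inject₁ℕ< i))) _

module Modulo (n : ℕ) where
  import Data.Nat as ℕ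
  import Data.Nat.Divisibility as ℕ
  open import Data.Integer using (ℤ; _+_; _*_; _-_; -_; 0ℤ)
  open import Data.Integer.Properties using (+-inverseʳ; *-zeroˡ; +-identityʳ; pos-+)
  open import Data.Integer.Divisibility.Signed
    using (_∣_; divides; ∣⇒∣ᵤ; ∣ᵤ⇒∣; ∣-refl; ∣m∣n⇒∣m+n; ∣m⇒∣-m; ∣m⇒∣m*n; ∣n⇒∣m*n)
  open import Data.Integer.Tactic.RingSolver using (solve-∀)
  open import Algebra.Structures using (IsCommutativeSemiring)
  open import Algebra.Structures.Biased using (isCommutativeSemiringˡ; isCommutativeMonoidˡ)
  open import Relation.Binary.Structures using (IsEquivalence)
  import Relation.Binary.Reasoning.Setoid

  infix 4 _∼_ _≈_

  record _∼_ (a b : ℤ) : Set where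
    constructor ∣⇒∼
    field
      ∼⇒∣ : + n ∣ a - b

  ≡⇒∼ : ∀ {a b} → a ≡ b → a ∼ b
  ≡⇒∼ {a} refl = ∣⇒∼ (divides 0ℤ (trans (+-inverseʳ a) (sym (*-zeroˡ (+ n)))))

  ∼-refl : ∀ {a} → a ∼ a
  ∼-refl = ≡⇒∼ refl

  ∼-sym : ∀ {a b} → a ∼ b → b ∼ a
  ∼-sym {a} {b} (∣⇒∼ n∣a-b) = ∣⇒∼ (subst (+ n ∣_) (negate a b) (∣m⇒∣-m n∣a-b))
    where
    negate : ∀ a b → - (a - b) ≡ b - a
    negate = solve-∀

  ∼-trans : ∀ {a b c} → a ∼ b → b ∼ c → a ∼ c
  ∼-trans {a} {b} {c} (∣⇒∼ n∣a-b) (∣⇒∼ n∣b-c) =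
    ∣⇒∼ (subst (+ n ∣_) (telescope a b c) (∣m∣n⇒∣m+n n∣a-b n∣b-c))
    where
    telescope : ∀ a b c → (a - b) + (b - c) ≡ a - c
    telescope = solve-∀

  ∼-+-cong : ∀ {a b c d} → a ∼ b → c ∼ d → a + c ∼ b + d
  ∼-+-cong {a} {b} {c} {d} (∣⇒∼ n∣a-b) (∣⇒∼ n∣c-d) =
    ∣⇒∼ (subst (+ n ∣_) (regroup a b c d) (∣m∣n⇒∣m+n n∣a-b n∣c-d))
    where
    regroup : ∀ a b c d → (a - b) + (c - d) ≡ (a + c) - (b + d)
    regroup = solve-∀

  ∼-*-cong : ∀ {a b c d} → a ∼ b → c ∼ d → a * c ∼ b * d
  ∼-*-cong {a} {b} {c} {d} (∣⇒∼ n∣a-b) (∣⇒∼ n∣c-d) =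
    ∣⇒∼ (subst (+ n ∣_) (regroup a b c d) (∣m∣n⇒∣m+n (∣m⇒∣m*n c n∣a-b) (∣n⇒∣m*n b n∣c-d)))
    where
    regroup : ∀ a b c d → (a - b) * c + b * (c - d) ≡ a * c - b * d
    regroup = solve-∀

  record _≈_ (x y : ℤ√2) : Set where
    constructor _,_
    field
      re-∼ : re x ∼ re y
      im-∼ : im x ∼ im y

  ≡⇒≈ : ∀ {x y} → x ≡ y → x ≈ y
  ≡⇒≈ refl = ∼-refl , ∼-refl

  ≈-isEquivalence : IsEquivalence _≈_
  ≈-isEquivalence = record
    { refl  = ∼-refl , ∼-refl
    ; sym   = λ (a , b) → ∼-sym a , ∼-sym b
    ; trans = λ (a , b) (c , d) → ∼-trans a c , ∼-trans b d
    }

  +√-cong : ∀ {x y u v} → x ≈ y → u ≈ v → x +√ u ≈ y +√ v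
  +√-cong (a , b) (c , d) = ∼-+-cong a c , ∼-+-cong b d

  *√-cong : ∀ {x y u v} → x ≈ y → u ≈ v → x *√ u ≈ y *√ v
  *√-cong (a , b) (c , d) =
    ∼-+-cong (∼-*-cong a c) (∼-*-cong (∼-refl {+ 2}) (∼-*-cong b d)) , ∼-+-cong (∼-*-cong a d) (∼-*-cong b c)

  isCommutativeSemiring : IsCommutativeSemiring _≈_ _+√_ _*√_ zero√ one√
  isCommutativeSemiring = isCommutativeSemiringˡ record
    { +-isCommutativeMonoid = isCommutativeMonoidˡ record
      { isSemigroup = record
        { isMagma = record { isEquivalence = ≈-isEquivalence ; ∙-cong = +√-cong }
        ; assoc   = λ x y z → ≡⇒≈ (+√-assoc x y z)
        }
      ; identityˡ = λ x → ≡⇒≈ (+√-identityˡ x)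
      ; comm      = λ x y → ≡⇒≈ (+√-comm x y)
      }
    ; *-isCommutativeMonoid = isCommutativeMonoidˡ record
      { isSemigroup = record
        { isMagma = record { isEquivalence = ≈-isEquivalence ; ∙-cong = *√-cong }
        ; assoc   = λ x y z → ≡⇒≈ (*√-assoc x y z)
        }
      ; identityˡ = λ x → ≡⇒≈ (*√-identityˡ x)
      ; comm      = λ x y → ≡⇒≈ (*√-comm x y)
      }
    ; distribʳ = λ x y z → ≡⇒≈ (*√-distribʳ x y z)
    ; zeroˡ    = λ x → ≡⇒≈ (*√-zeroˡ x)
    }

  commutativeSemiring : CommutativeSemiring 0ℓ 0ℓ
  commutativeSemiring = record { isCommutativeSemiring = isCommutativeSemiring }

  open CommutativeSemiring commutativeSemiring public using (setoid; *-congˡ; +-cong)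
  open CommutativeSemiring commutativeSemiring using (semiring)
  open import Algebra.Properties.Semiring.Exp semiring using (_^_; ^-congˡ; ^-assocʳ)
  open import Algebra.Properties.Semiring.Mult semiring using (_×_)
  module ≈-Reasoning = Relation.Binary.Reasoning.Setoid setoid

  ^≡^√ : ∀ x k → x ^ k ≡ x ^√ k
  ^≡^√ x zero    = refl
  ^≡^√ x (suc k) = cong (x *√_) (^≡^√ x k)

  ^√-congˡ : ∀ k {x y} → x ≈ y → x ^√ k ≈ y ^√ k
  ^√-congˡ k {x} {y} x≈y = subst₂ _≈_ (^≡^√ x k) (^≡^√ y k) (^-congˡ k x≈y)

  ^√-assocʳ : ∀ x a b → (x ^√ a) ^√ b ≈ x ^√ (a ℕ.* b)
  ^√-assocʳ x a b =
    subst₂ _≈_ (trans (cong (_^ b) (^≡^√ x a)) (^≡^√ (x ^√ a) b)) (^≡^√ x (a ℕ.* b)) (^-assocʳ x a b)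

  ×one√≡ι : ∀ k → k × one√ ≡ ι (+ k)
  ×one√≡ι zero    = refl
  ×one√≡ι (suc k) = cong (one√ +√_) (×one√≡ι k)

  n×one√≈0 : n × one√ ≈ zero√
  n×one√≈0 = subst (_≈ zero√) (sym (×one√≡ι n)) (n∼0 , ∼-refl)
    where
    n∼0 : + n ∼ + 0
    n∼0 = ∣⇒∼ (subst (+ n ∣_) (sym (+-identityʳ (+ n))) ∣-refl)

  frobenius : Prime n → ∀ x y → (x +√ y) ^√ n ≈ x ^√ n +√ y ^√ n
  frobenius n-prime x y = subst₂ _≈_ (^≡^√ (x +√ y) n) (cong₂ _+√_ (^≡^√ x n) (^≡^√ y n))
    (Frobenius.frobenius commutativeSemiring n-prime n×one√≈0 x y)

  ι≈ι⇒∣ : ∀ {a m} → ι (+ (a ℕ.+ m)) ≈ ι (+ a) → n ℕ.∣ m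
  ι≈ι⇒∣ {a} {m} (∣⇒∼ n∣a+m-a , _) = ∣⇒∣ᵤ (subst (+ n ∣_) (a+m-a≡m (+ a) (+ m)) n∣a+m-a')
    where
    a+m-a≡m : ∀ a m → (a + m) - a ≡ m
    a+m-a≡m = solve-∀
    n∣a+m-a' : + n ∣ (+ a + + m) - + a
    n∣a+m-a' = subst (λ k → + n ∣ k - + a) (pos-+ a m) n∣a+m-a

  ∣⇒ι≈-1√ : ∀ {a} → n ℕ.∣ a ℕ.+ 1 → ι (+ a) ≈ -1√
  ∣⇒ι≈-1√ n∣a+1 = ∣⇒∼ (∣ᵤ⇒∣ n∣a+1) , ∼-refl

  ≈-1√⇒∣√+1 : ∀ {x} → x ≈ -1√ → (+ n) ∣√ (x +√ one√)
  ≈-1√⇒∣√+1 (∣⇒∼ n∣re , ∣⇒∼ n∣im) = ∣⇒∣ᵤ n∣re , ∣⇒∣ᵤ n∣im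

open import Data.Nat using (_≤_; _<_; _+_; _/_; _*_; _^_; z≤n; s≤s; parity)
open import Data.Nat.Properties using (≤-trans; *-comm; *-assoc)
open import Data.Nat.Divisibility using (_∣_; _∣0; divides; ∣-refl; ∣m∣n⇒∣m+n; >⇒∤)
open import Data.Nat.DivMod using (m*n/n≡m)
open import Data.Nat.Primality using (prime⇒irreducible)
open import Data.Nat.Tactic.RingSolver using (solve-∀)
open import Data.Parity.Base as ℙ using (0ℙ; 1ℙ)
import Data.Parity.Properties as ℙ

even⇒2∣ : ∀ n → parity n ≡ 0ℙ → 2 ∣ n
even⇒2∣ zero          _    = 2 ∣0
even⇒2∣ (suc (suc n)) even = ∣m∣n⇒∣m+n ∣-refl (even⇒2∣ n even)

prime⇒odd : ∀ {p} → Prime p → 3 ≤ p → parity p ≡ 1ℙ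
prime⇒odd {p} p-prime 3≤p with parity p in eq
... | 1ℙ = refl
... | 0ℙ with prime⇒irreducible p-prime (even⇒2∣ p eq)
...   | inj₁ ()
...   | inj₂ refl = contradiction 3≤p λ { (s≤s (s≤s ())) }

odd-*⇒oddˡ : ∀ m n → parity (m * n) ≡ 1ℙ → parity m ≡ 1ℙ
odd-*⇒oddˡ m n odd with parity m | ℙ.*-homo-* m n
... | 1ℙ | _  = refl
... | 0ℙ | eq = contradiction (trans (sym odd) eq) λ ()

1+4*-odd : ∀ s → parity (1 + 4 * s) ≡ 1ℙ
1+4*-odd s = trans (ℙ.+-homo-+ 1 (4 * s)) (cong (1ℙ ℙ.+_) (ℙ.*-homo-* 4 s))

-- The factor 1 + 4 * s makes t = (2^n − 2)/6 visibly odd.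
2^odd≡2+6*[1+4*] : ∀ n → 3 ≤ n → parity n ≡ 1ℙ → ∃[ s ] 2 ^ n ≡ 2 + 6 * (1 + 4 * s)
2^odd≡2+6*[1+4*] 1 (s≤s ()) _
2^odd≡2+6*[1+4*] 3 _ _ = 0 , refl
2^odd≡2+6*[1+4*] (suc (suc n@(suc (suc (suc _))))) _ odd
  with s , 2^n≡ ← 2^odd≡2+6*[1+4*] n (s≤s (s≤s (s≤s z≤n))) odd
  = 1 + 4 * s , trans (cong (λ m → 2 * (2 * m)) 2^n≡) (step s)
  where
  step : ∀ s → 2 * (2 * (2 + 6 * (1 + 4 * s))) ≡ 2 + 6 * (1 + 4 * (1 + 4 * s))
  step = solve-∀

W≡1+2* : ∀ p t → 2 ^ p ≡ 2 + 6 * t → W p ≡ 1 + 2 * t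
W≡1+2* p t 2^p≡ = begin
  (2 ^ p + 1) / 3          ≡⟨ cong (λ m → (m + 1) / 3) 2^p≡ ⟩
  (2 + 6 * t + 1) / 3      ≡⟨ cong (_/ 3) (factor t) ⟩
  (1 + 2 * t) * 3 / 3      ≡⟨ m*n/n≡m (1 + 2 * t) 3 ⟩
  1 + 2 * t                ∎
  where
  open ≡-Reasoning
  factor : ∀ t → 2 + 6 * t + 1 ≡ (1 + 2 * t) * 3
  factor = solve-∀

[1+2*t+1]/2≡1+t : ∀ t → (1 + 2 * t + 1) / 2 ≡ 1 + t
[1+2*t+1]/2≡1+t t = trans (cong (_/ 2) (factor t)) (m*n/n≡m (1 + t) 2)
  where
  factor : ∀ t → 1 + 2 * t + 1 ≡ (1 + t) * 2
  factor = solve-∀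

fermat₂ : ∀ {q m} → Prime q → 2 ^ q ≡ 2 + m → q ∣ m
fermat₂ {q} {m} q-prime 2^q≡2+m = ι≈ι⇒∣ (begin
  ι (+ (2 + m))              ≡⟨ cong (λ k → ι (+ k)) 2^q≡2+m ⟨
  ι (+ (2 ^ q))              ≡⟨ ι-^√ 2 q ⟨
  (one√ +√ one√) ^√ q        ≈⟨ frobenius q-prime one√ one√ ⟩
  one√ ^√ q +√ one√ ^√ q     ≡⟨ cong₂ _+√_ (one√-^√ q) (one√-^√ q) ⟩
  ι (+ 2)                    ∎)
  where
  open Modulo q
  open ≈-Reasoning

module _ {p t : ℕ} (p-prime : Prime p) (5≤p : 5 ≤ p)
         (2^p≡2+6t : 2 ^ p ≡ 2 + 6 * t) (t-odd : parity t ≡ 1ℙ) where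
  open Modulo (1 + 2 * t)
  open ≈-Reasoning

  p∣t : p ∣ t
  p∣t = ∣m*n∧∤m⇒∣n p-prime (∣m*n∧∤m⇒∣n p-prime p∣2*[3*t] (>⇒∤ 2<p)) (>⇒∤ 3<p)
    where
    p∣2*[3*t] : p ∣ 2 * (3 * t)
    p∣2*[3*t] = subst (p ∣_) (*-assoc 2 3 t) (fermat₂ p-prime 2^p≡2+6t)
    3<p : 3 < p
    3<p = ≤-trans (s≤s (s≤s (s≤s (s≤s z≤n)))) 5≤p
    2<p : 2 < p
    2<p = ≤-trans (s≤s (s≤s (s≤s z≤n))) 5≤p

  2^p≈-1 : ι (+ 2) ^√ p ≈ -1√
  2^p≈-1 = subst (_≈ -1√) (sym (ι-^√ 2 p)) (∣⇒ι≈-1√ (divides 3 2^p+1≡3*[1+2*t]))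
    where
    factor : ∀ t → 2 + 6 * t + 1 ≡ 3 * (1 + 2 * t)
    factor = solve-∀
    2^p+1≡3*[1+2*t] : 2 ^ p + 1 ≡ 3 * (1 + 2 * t)
    2^p+1≡3*[1+2*t] = trans (cong (_+ 1) 2^p≡2+6t) (factor t)

  2^t≈-1 : ι (+ 2) ^√ t ≈ -1√
  2^t≈-1 = begin
    ι (+ 2) ^√ t           ≡⟨ cong (ι (+ 2) ^√_) (trans t≡k*p (*-comm k p)) ⟩
    ι (+ 2) ^√ (p * k)     ≈⟨ ^√-assocʳ (ι (+ 2)) p k ⟨
    (ι (+ 2) ^√ p) ^√ k    ≈⟨ ^√-congˡ k 2^p≈-1 ⟩
    -1√ ^√ k               ≡⟨ -1√-^√-odd k (odd-*⇒oddˡ k p (subst (λ m → parity m ≡ 1ℙ) t≡k*p t-odd)) ⟩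
    -1√                    ∎
    where
    open _∣_ p∣t renaming (quotient to k; equality to t≡k*p)

  √2^[1+2*t]≈-√2 : √2 ^√ (1 + 2 * t) ≈ -√2
  √2^[1+2*t]≈-√2 = begin
    √2 *√ √2 ^√ (2 * t)    ≈⟨ *-congˡ {√2} (^√-assocʳ √2 2 t) ⟨
    √2 *√ ι (+ 2) ^√ t     ≈⟨ *-congˡ {√2} 2^t≈-1 ⟩
    √2 *√ -1√              ∎

  [1+√2]^[1+2*t]≈1-√2 : Prime (1 + 2 * t) → 1+√2 ^√ (1 + 2 * t) ≈ 1-√2
  [1+√2]^[1+2*t]≈1-√2 w-prime = begin
    (one√ +√ √2) ^√ (1 + 2 * t)                ≈⟨ frobenius w-prime one√ √2 ⟩
    one√ ^√ (1 + 2 * t) +√ √2 ^√ (1 + 2 * t)   ≈⟨ +-cong (≡⇒≈ (one√-^√ (1 + 2 * t))) √2^[1+2*t]≈-√2 ⟩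
    one√ +√ -√2                                ∎

  ω₃^[1+t]≈-1 : Prime (1 + 2 * t) → ω₃ ^√ (1 + t) ≈ -1√
  ω₃^[1+t]≈-1 w-prime = begin
    (1+√2 ^√ 2) ^√ (1 + t)            ≈⟨ ^√-assocʳ 1+√2 2 (1 + t) ⟩
    1+√2 ^√ (2 * (1 + t))             ≡⟨ cong (1+√2 ^√_) (double t) ⟩
    1+√2 *√ 1+√2 ^√ (1 + 2 * t)       ≈⟨ *-congˡ {1+√2} ([1+√2]^[1+2*t]≈1-√2 w-prime) ⟩
    1+√2 *√ 1-√2                      ∎
    where
    double : ∀ t → 2 * (1 + t) ≡ 2 + 2 * t
    double = solve-∀

  w∣√ω₃^[w+1]/2+1 : ∀ {w} → w ≡ 1 + 2 * t → Prime w → (+ w) ∣√ (ω₃ ^√ ((w + 1) / 2) +√ one√)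
  w∣√ω₃^[w+1]/2+1 refl w-prime =
    subst (λ e → (+ (1 + 2 * t)) ∣√ (ω₃ ^√ e +√ one√)) (sym ([1+2*t+1]/2≡1+t t))
      (≈-1√⇒∣√+1 (ω₃^[1+t]≈-1 w-prime))

proposition2p3 : (p : ℕ) → Prime p → 5 ≤ p → Prime (W p) →
    (+ (W p)) ∣√ ((ω₃ ^√ ((W p + 1) / 2)) +√ one√)
proposition2p3 p p-prime 5≤p W-prime
  with 3≤p ← ≤-trans (s≤s (s≤s (s≤s z≤n))) 5≤p
  with s , 2^p≡2+6t ← 2^odd≡2+6*[1+4*] p 3≤p (prime⇒odd p-prime 3≤p)
  = w∣√ω₃^[w+1]/2+1 {t = 1 + 4 * s} p-prime 5≤p 2^p≡2+6t (1+4*-odd s)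
      (W≡1+2* p (1 + 4 * s) 2^p≡2+6t) W-prime
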